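{- Let $n>4$ and let $W_n$ be the wheel graph on $n$ vertices. Then $T_2(W_n)=2$ and $B_2(W_n)=1$.
   Context: The wheel graph $W_n$ consists of a cycle on $n-1$ vertices (the outer cycle) together with one additional vertex (the hub) adjacent to every vertex of the cycle; the edges from the hub are called spokes. A tile is a vertex together with a finite multiset of half-edges, each half-edge labeled by a cohesive-end symbol $a$ or its complement $\hat a$, where $a$ ranges over an alphabet of bond-edge types. A pot $P$ is a finite set of distinct tile types. A graph $G$ (loops and multiple edges allowed) is realized (constructed) by $P$ if each vertex of $G$ can be assigned a copy of some tile type in $P$ (any number of copies of each type may be used) so that the half-edges at each vertex are in bijection with the edge-ends at that vertex and every edge of $G$ is formed by joining a half-edge labeled $a$ with a half-edge labeled $\hat a$ for some bond-edge type $a$, with no half-edge left unmatched. $C(P)$ denotes the set of graphs realized by $P$, and $C_{min}(P)$ the set of graphs of minimum order in $C(P)$. For a target graph $G$: in Scenario 1 the only requirement on $P$ is $G\in C(P)$; in Scenario 2 one requires $G\in C(P)$ and that no graph of smaller order than $G$ is in $C(P)$ (nonisomorphic graphs of the same order are allowed); in Scenario 3 one requires $C_{min}(P)=\{G\}$ (up to isomorphism). $B_i(G)$ is the minimum number of bond-edge types, and $T_i(G)$ the minimum number of tile types, over all pots satisfying the requirements of Scenario $i$ for $G$. -}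

module Defs where

open import Data.Nat using (ℕ; zero; suc; _≤_; _<_)
open import Data.Nat.DivMod using (_mod_)
open import Data.Fin using (Fin; zero; suc; toℕ; _≟_)
open import Data.List using (List; []; _∷_; _++_; map; length; lookup; allFin; concatMap)
open import Data.List.Relation.Binary.Permutation.Propositional using (_↭_)
open import Data.List.Relation.Unary.AllPairs using (AllPairs)
open import Data.Bool using (Bool; true; false; not; if_then_else_)
open import Data.Product using (Σ; _×_; _,_; proj₁; ∃)
open import Relation.Nullary using (¬_; does)
open import Relation.Binary.PropositionalEquality using (_≡_)

-- Graphs (loops and multiple edges allowed): a graph of order m has
-- vertex set Fin m and a finite list (multiset) of edges, each edge
-- given by its two end vertices.

Graph : ℕ → Set
Graph m = List (Fin m × Fin m)

-- Wheel graph W_n: hub = vertex zero, outer cycle on the n-1 vertices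
-- suc i (i : Fin (n-1)), spokes from the hub to every cycle vertex.

rot : ∀ {c} → Fin c → Fin c
rot {suc c} i = suc (toℕ i) mod (suc c)

wheel : (n : ℕ) → Graph n
wheel zero = []
wheel (suc c) =
  map (λ i → (zero , suc i)) (allFin c) ++
  map (λ i → (suc i , suc (rot i))) (allFin c)

-- Tiles and pots over an alphabet of k bond-edge types (Fin k).
-- A half-edge label is (a , h) where h = false means the cohesive end a
-- and h = true means its complement â.

Label : ℕ → Set
Label k = Fin k × Bool

-- a tile type: a finite multiset of half-edge labels (list up to ↭)
Tile : ℕ → Set
Tile k = List (Label k)

Pot : ℕ → Set
Pot k = List (Tile k)

ValidPot : ∀ {k} → Pot k → Set
ValidPot P = AllPairs (λ s t → ¬ (s ↭ t)) P

-- Each edge (u , v) is given a bond-edge type a and a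
-- flag h: the end at u carries label (a , h) and the end at v carries
-- the complementary label (a , not h).

LabeledEdge : ℕ → ℕ → Set
LabeledEdge m k = (Fin m × Fin m) × Label k

halfEdgesAt : ∀ {m k} → List (LabeledEdge m k) → Fin m → List (Label k)
halfEdgesAt L v = concatMap f L
  where
  f : _ → _
  f ((x , y) , (a , h)) =
    (if does (x ≟ v) then (a , h) ∷ [] else []) ++
    (if does (y ≟ v) then (a , not h) ∷ [] else [])

Realizes : ∀ {k m} → Pot k → Graph m → Set
Realizes {k} {m} P G =
  Σ (Fin m → Fin (length P)) λ t →
  Σ (List (LabeledEdge m k)) λ L →
    (map proj₁ L ≡ G) × (∀ v → halfEdgesAt L v ↭ lookup P (t v))

Scenario2 : ∀ {k n} → Pot k → Graph n → Set
Scenario2 {k} {n} P G =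
  ValidPot P × Realizes P G ×
  (∀ m → 1 ≤ m → m < n → (H : Graph m) → ¬ Realizes P H)

T₂ : ∀ {n} → Graph n → ℕ → Set
T₂ G t =
  (∃ λ k → Σ (Pot k) λ P → length P ≡ t × Scenario2 P G) ×
  (∀ k (P : Pot k) → Scenario2 P G → t ≤ length P)

B₂ : ∀ {n} → Graph n → ℕ → Set
B₂ G b =
  (Σ (Pot b) λ P → Scenario2 P G) ×
  (∀ k (P : Pot k) → Scenario2 P G → b ≤ k)

{-# OPTIONS --safe #-}
-- The upper bound is the pot {a^(n-1), a â â}: orient every spoke away from the hub and the
-- outer cycle cyclically, and label all edges with the single bond-edge type a.  Any graph
-- realized by this pot, with Z hub tiles and O rim tiles, has as many ends a as ends â, so
-- (n-1) Z + O = 2 O; hence its order Z + O = n Z is a multiple of n.  One tile type cannot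
-- realize W_n because the hub has degree n-1 > 3 while rim vertices have degree 3, and zero
-- bond-edge types realize no edge at all.
module Submission where

open import Defs
open import Data.Bool using (Bool; true; false; not; if_then_else_)
open import Data.Bool.Properties using (if-float) renaming (_≟_ to _≟ᵇ_)
open import Data.Fin using (Fin; zero; suc; toℕ; fromℕ; inject₁; _≟_)
open import Data.Fin.Properties using (toℕ-injective; toℕ-fromℕ<; toℕ-fromℕ; toℕ-inject₁; toℕ<n; suc-injective)
open import Data.List using (List; []; _∷_; _++_; map; length; lookup; allFin; tabulate; replicate)
open import Data.List.Properties using (length-++; length-replicate; length-tabulate; map-tabulate; map-∘; map-id)
open import Data.List.Relation.Binary.Permutation.Propositional using (_↭_; refl; prep; swap; trans; ↭-sym; ↭-trans)
open import Data.List.Relation.Binary.Permutation.Propositional.Properties using (shift; ↭-length)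
open import Data.List.Relation.Unary.All using ([]; _∷_)
open import Data.List.Relation.Unary.AllPairs using ([]; _∷_)
open import Data.Nat using (ℕ; zero; suc; _+_; _*_; _≤_; _<_; z≤n; s≤s; >-nonZero)
open import Data.Nat.DivMod using (_%_; m<n⇒m%n≡m; n%n≡0)
open import Data.Nat.Divisibility using (_∣_; divides; ∣⇒≤)
open import Data.Nat.Properties using (+-*-semiring; +-suc; +-identityʳ; *-identityʳ; *-zeroʳ; *-comm; +-cancelʳ-≡; >⇒≢; <⇒≱; ≤-trans)
open import Algebra.Properties.Semiring.Sum +-*-semiring
  using (sum; sum-syntax; sum-cong-≗; sum-replicate-zero; ∑-distrib-+; *-distribˡ-sum)
open import Data.Product using (∃; _×_; _,_; proj₁; proj₂)
open import Data.Sum using (_⊎_; inj₁; inj₂)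
open import Function using (_∘_; id)
open import Function.Definitions using (Injective)
open import Relation.Nullary using (¬_; does; yes; no; contradiction)
open import Relation.Binary.PropositionalEquality
  using (_≡_; _≢_; refl; sym; cong; cong₂; subst₂; module ≡-Reasoning)
  renaming (trans to ≡-trans)

count : {A : Set} → (A → Bool) → List A → ℕ
count p []       = 0
count p (x ∷ xs) = if p x then suc (count p xs) else count p xs

module _ {A : Set} (p : A → Bool) where

  count-++ : ∀ xs ys → count p (xs ++ ys) ≡ count p xs + count p ys
  count-++ []       ys = refl
  count-++ (x ∷ xs) ys with p x
  ... | true  = cong suc (count-++ xs ys)
  ... | false = count-++ xs ys

  count-↭ : ∀ {xs ys} → xs ↭ ys → count p xs ≡ count p ys
  count-↭ refl = refl
  count-↭ (prep x r) with p x
  ... | true  = cong suc (count-↭ r)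
  ... | false = count-↭ r
  count-↭ (swap x y r) with p x | p y
  ... | true  | true  = cong (2 +_) (count-↭ r)
  ... | true  | false = cong suc (count-↭ r)
  ... | false | true  = cong suc (count-↭ r)
  ... | false | false = count-↭ r
  count-↭ (trans r s) = ≡-trans (count-↭ r) (count-↭ s)

  count-map : ∀ {B : Set} (f : B → A) xs → count p (map f xs) ≡ count (p ∘ f) xs
  count-map f []       = refl
  count-map f (x ∷ xs) with p (f x)
  ... | true  = cong suc (count-map f xs)
  ... | false = count-map f xs

  count-cong : ∀ {q : A → Bool} → (∀ x → p x ≡ q x) → ∀ xs → count p xs ≡ count q xs
  count-cong p≗q []       = refl
  count-cong {q} p≗q (x ∷ xs) with p x | q x | p≗q x
  ... | true  | true  | refl = cong suc (count-cong p≗q xs)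
  ... | false | false | refl = count-cong p≗q xs

count-false : {A : Set} (xs : List A) → count (λ _ → false) xs ≡ 0
count-false []       = refl
count-false (x ∷ xs) = count-false xs

count-true : {A : Set} (xs : List A) → count (λ _ → true) xs ≡ length xs
count-true []       = refl
count-true (x ∷ xs) = cong suc (count-true xs)

count-tabulate-suc : ∀ {n} (p : Fin (suc n) → Bool) → count p (tabulate suc) ≡ count (p ∘ suc) (allFin n)
count-tabulate-suc {n} p = ≡-trans (cong (count p) (sym (map-tabulate id suc))) (count-map p suc (allFin n))

count-allFin-≟ : ∀ {n} (j : Fin n) → count (λ i → does (i ≟ j)) (allFin n) ≡ 1
count-allFin-≟ {suc n} zero    = cong suc (≡-trans (count-tabulate-suc {n} (λ i → does (i ≟ zero))) (count-false (allFin n)))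
count-allFin-≟ {suc n} (suc j) = ≡-trans (count-tabulate-suc {n} (λ i → does (i ≟ suc j))) (count-allFin-≟ j)

does-≟-injective : ∀ {m n} {f : Fin m → Fin n} → Injective _≡_ _≡_ f →
                   ∀ i j → does (f i ≟ f j) ≡ does (i ≟ j)
does-≟-injective {f = f} f-inj i j with i ≟ j | f i ≟ f j
... | yes _    | yes _     = refl
... | yes refl | no fi≢fi  = contradiction refl fi≢fi
... | no i≢j   | yes fi≡fj = contradiction (f-inj fi≡fj) i≢j
... | no _     | no _      = refl

count-allFin-fibre : ∀ {m n} {f : Fin m → Fin n} → Injective _≡_ _≡_ f →
                     ∀ i₀ → count (λ i → does (f i ≟ f i₀)) (allFin m) ≡ 1
count-allFin-fibre f-inj i₀ =
  ≡-trans (count-cong _ (λ i → does-≟-injective f-inj i i₀) (allFin _)) (count-allFin-≟ i₀)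

∑-one : ∀ m → ∑[ v < m ] 1 ≡ m
∑-one zero    = refl
∑-one (suc m) = cong suc (∑-one m)

∑-suc : ∀ {m} (f : Fin m → ℕ) → ∑[ v < m ] suc (f v) ≡ m + ∑[ v < m ] f v
∑-suc {m} f = ≡-trans (∑-distrib-+ (λ _ → 1) f) (cong (_+ sum f) (∑-one m))

∑-δ : ∀ {m} (x : Fin m) k → ∑[ v < m ] (if does (x ≟ v) then k else 0) ≡ k
∑-δ {suc m} zero    k = ≡-trans (cong (k +_) (sum-replicate-zero m)) (+-identityʳ k)
∑-δ {suc m} (suc x) k = ∑-δ x k

fromℕ-or-inject₁ : ∀ {c} (i : Fin (suc c)) → i ≡ fromℕ c ⊎ ∃ λ j → i ≡ inject₁ j
fromℕ-or-inject₁ {zero}  zero    = inj₁ refl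
fromℕ-or-inject₁ {suc c} zero    = inj₂ (zero , refl)
fromℕ-or-inject₁ {suc c} (suc i) with fromℕ-or-inject₁ i
... | inj₁ refl       = inj₁ refl
... | inj₂ (j , refl) = inj₂ (suc j , refl)

rot-fromℕ : ∀ c → rot (fromℕ c) ≡ zero
rot-fromℕ c = toℕ-injective (begin
  toℕ (rot (fromℕ c))         ≡⟨ toℕ-fromℕ< _ ⟩
  suc (toℕ (fromℕ c)) % suc c ≡⟨ cong (λ x → suc x % suc c) (toℕ-fromℕ c) ⟩
  suc c % suc c               ≡⟨ n%n≡0 (suc c) ⟩
  0                           ∎)
  where open ≡-Reasoning

rot-inject₁ : ∀ {c} (j : Fin c) → rot (inject₁ j) ≡ suc j
rot-inject₁ {c} j = toℕ-injective (begin
  toℕ (rot (inject₁ j))         ≡⟨ toℕ-fromℕ< _ ⟩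
  suc (toℕ (inject₁ j)) % suc c ≡⟨ cong (λ x → suc x % suc c) (toℕ-inject₁ j) ⟩
  suc (toℕ j) % suc c           ≡⟨ m<n⇒m%n≡m (s≤s (toℕ<n j)) ⟩
  suc (toℕ j)                   ∎)
  where open ≡-Reasoning

rot-injective : ∀ {c} → Injective _≡_ _≡_ (rot {suc c})
rot-injective {c} {i} {j} eq with fromℕ-or-inject₁ i | fromℕ-or-inject₁ j
... | inj₁ refl        | inj₁ refl        = refl
... | inj₁ refl        | inj₂ (j′ , refl) with () ← ≡-trans (sym (rot-fromℕ c)) (≡-trans eq (rot-inject₁ j′))
... | inj₂ (i′ , refl) | inj₁ refl        with () ← ≡-trans (sym (rot-fromℕ c)) (≡-trans (sym eq) (rot-inject₁ i′))
... | inj₂ (i′ , refl) | inj₂ (j′ , refl) =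
  cong inject₁ (suc-injective (≡-trans (sym (rot-inject₁ i′)) (≡-trans eq (rot-inject₁ j′))))

rot-surjective : ∀ {c} (j : Fin (suc c)) → ∃ λ i → rot i ≡ j
rot-surjective {c} zero = fromℕ c , rot-fromℕ c
rot-surjective (suc j)  = inject₁ j , rot-inject₁ j

-- Degrees of the wheel

outDegree inDegree degree : ∀ {m} → Graph m → Fin m → ℕ
outDegree G v = count (λ e → does (proj₁ e ≟ v)) G
inDegree  G v = count (λ e → does (proj₂ e ≟ v)) G
degree    G v = outDegree G v + inDegree G v

spoke rimEdge : ∀ {c} → Fin c → Fin (suc c) × Fin (suc c)
spoke   i = zero , suc i
rimEdge i = suc i , suc (rot i)

count-wheel : ∀ {c} (p : Fin (suc c) × Fin (suc c) → Bool) →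
              count p (wheel (suc c)) ≡ count (p ∘ spoke) (allFin c) + count (p ∘ rimEdge) (allFin c)
count-wheel {c} p = ≡-trans (count-++ p (map spoke (allFin c)) (map rimEdge (allFin c)))
                            (cong₂ _+_ (count-map p spoke (allFin c)) (count-map p rimEdge (allFin c)))

wheel-outDegree-hub : ∀ {c} → outDegree (wheel (suc c)) zero ≡ c
wheel-outDegree-hub {c} = begin
  outDegree (wheel (suc c)) zero                                  ≡⟨ count-wheel {c} (λ e → does (proj₁ e ≟ zero)) ⟩
  count (λ _ → true) (allFin c) + count (λ _ → false) (allFin c) ≡⟨ cong₂ _+_ (count-true (allFin c)) (count-false (allFin c)) ⟩
  length (allFin c) + 0                                           ≡⟨ +-identityʳ _ ⟩
  length (allFin c)                                               ≡⟨ length-tabulate _ ⟩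
  c                                                               ∎
  where open ≡-Reasoning

wheel-inDegree-hub : ∀ {c} → inDegree (wheel (suc c)) zero ≡ 0
wheel-inDegree-hub {c} = ≡-trans (count-wheel {c} (λ e → does (proj₂ e ≟ zero)))
                                 (cong₂ _+_ (count-false (allFin c)) (count-false (allFin c)))

wheel-outDegree-rim : ∀ {c} (j : Fin c) → outDegree (wheel (suc c)) (suc j) ≡ 1
wheel-outDegree-rim {c} j = ≡-trans (count-wheel {c} (λ e → does (proj₁ e ≟ suc j)))
                                    (cong₂ _+_ (count-false (allFin c)) (count-allFin-≟ j))

wheel-inDegree-rim : ∀ {c} (j : Fin c) → inDegree (wheel (suc c)) (suc j) ≡ 2
wheel-inDegree-rim {suc c} j with rot-surjective j
... | i₀ , refl = ≡-trans (count-wheel {suc c} (λ e → does (proj₂ e ≟ suc (rot i₀))))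
                          (cong₂ _+_ (count-allFin-≟ (rot i₀)) (count-allFin-fibre rot-injective i₀))

wheel-degree-hub : ∀ {c} → degree (wheel (suc c)) zero ≡ c
wheel-degree-hub {c} = ≡-trans (cong₂ _+_ wheel-outDegree-hub (wheel-inDegree-hub {c})) (+-identityʳ c)

wheel-degree-rim : ∀ {c} (j : Fin c) → degree (wheel (suc c)) (suc j) ≡ 3
wheel-degree-rim j = cong₂ _+_ (wheel-outDegree-rim j) (wheel-inDegree-rim j)

endAt : ∀ {m k} → Fin m → Label k → Fin m → List (Label k)
endAt x l v = if does (x ≟ v) then l ∷ [] else []

-- The local function of halfEdgesAt, so that halfEdgesAt (e ∷ L) v reduces to endsAt e v ++ halfEdgesAt L v.
endsAt : ∀ {m k} → LabeledEdge m k → Fin m → List (Label k)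
endsAt ((x , y) , (a , h)) v = endAt x (a , h) v ++ endAt y (a , not h) v

length-halfEdgesAt : ∀ {m k} (L : List (LabeledEdge m k)) v →
                     length (halfEdgesAt L v) ≡ degree (map proj₁ L) v
length-halfEdgesAt []                      v = refl
length-halfEdgesAt (((x , y) , _) ∷ L) v with x ≟ v | y ≟ v
... | yes _ | yes _ = cong suc (≡-trans (cong suc (length-halfEdgesAt L v)) (sym (+-suc _ _)))
... | yes _ | no _  = cong suc (length-halfEdgesAt L v)
... | no _  | yes _ = ≡-trans (cong suc (length-halfEdgesAt L v)) (sym (+-suc _ _))
... | no _  | no _  = length-halfEdgesAt L v

realization-tile-length : ∀ {k m} {P : Pot k} {G : Graph m} (R : Realizes P G) v →
                          length (lookup P (proj₁ R v)) ≡ degree G v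
realization-tile-length (t , L , refl , halfEdges↭) v =
  ≡-trans (sym (↭-length (halfEdges↭ v))) (length-halfEdgesAt L v)

realizes-no-bonds : ∀ {m} {P : Pot 0} {G : Graph m} → Realizes P G → G ≡ []
realizes-no-bonds (_ , []                  , refl , _) = refl
realizes-no-bonds (_ , (_ , (() , _)) ∷ _ , _    , _)

flagCount : ∀ {k} → Bool → List (Label k) → ℕ
flagCount h = count (λ l → does (proj₂ l ≟ᵇ h))

flagCount-complementary : ∀ {k} h (a : Fin k) h′ →
                          flagCount h ((a , h′) ∷ []) + flagCount h ((a , not h′) ∷ []) ≡ 1
flagCount-complementary false a false = refl
flagCount-complementary false a true  = refl
flagCount-complementary true  a false = refl
flagCount-complementary true  a true  = refl

∑-flagCount-endAt : ∀ {m k} h (x : Fin m) (l : Label k) → ∑[ v < m ] flagCount h (endAt x l v) ≡ flagCount h (l ∷ [])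
∑-flagCount-endAt h x l = ≡-trans (sum-cong-≗ (λ v → if-float (flagCount h) (does (x ≟ v)))) (∑-δ x _)

∑-flagCount-endsAt : ∀ {m k} h (e : LabeledEdge m k) → ∑[ v < m ] flagCount h (endsAt e v) ≡ 1
∑-flagCount-endsAt {m} h ((x , y) , (a , h′)) = begin
  ∑[ v < m ] flagCount h (endAt x (a , h′) v ++ endAt y (a , not h′) v)
    ≡⟨ sum-cong-≗ (λ v → count-++ _ (endAt x (a , h′) v) (endAt y (a , not h′) v)) ⟩
  ∑[ v < m ] (flagCount h (endAt x (a , h′) v) + flagCount h (endAt y (a , not h′) v))
    ≡⟨ ∑-distrib-+ (λ v → flagCount h (endAt x (a , h′) v)) (λ v → flagCount h (endAt y (a , not h′) v)) ⟩
  ∑[ v < m ] flagCount h (endAt x (a , h′) v) + ∑[ v < m ] flagCount h (endAt y (a , not h′) v)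
    ≡⟨ cong₂ _+_ (∑-flagCount-endAt h x (a , h′)) (∑-flagCount-endAt h y (a , not h′)) ⟩
  flagCount h ((a , h′) ∷ []) + flagCount h ((a , not h′) ∷ [])
    ≡⟨ flagCount-complementary h a h′ ⟩
  1 ∎
  where open ≡-Reasoning

∑-flagCount-halfEdgesAt : ∀ {m k} h (L : List (LabeledEdge m k)) →
                          ∑[ v < m ] flagCount h (halfEdgesAt L v) ≡ length L
∑-flagCount-halfEdgesAt {m} h [] = sum-replicate-zero m
∑-flagCount-halfEdgesAt {m} h (e ∷ L) = begin
  ∑[ v < m ] flagCount h (endsAt e v ++ halfEdgesAt L v)
    ≡⟨ sum-cong-≗ (λ v → count-++ _ (endsAt e v) (halfEdgesAt L v)) ⟩
  ∑[ v < m ] (flagCount h (endsAt e v) + flagCount h (halfEdgesAt L v))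
    ≡⟨ ∑-distrib-+ (λ v → flagCount h (endsAt e v)) (λ v → flagCount h (halfEdgesAt L v)) ⟩
  ∑[ v < m ] flagCount h (endsAt e v) + ∑[ v < m ] flagCount h (halfEdgesAt L v)
    ≡⟨ cong₂ _+_ (∑-flagCount-endsAt h e) (∑-flagCount-halfEdgesAt h L) ⟩
  suc (length L) ∎
  where open ≡-Reasoning

realization-balanced : ∀ {k m} {P : Pot k} {G : Graph m} (R : Realizes P G) →
                       ∑[ v < m ] flagCount false (lookup P (proj₁ R v)) ≡
                       ∑[ v < m ] flagCount true  (lookup P (proj₁ R v))
realization-balanced {m = m} {P} (t , L , _ , halfEdges↭) =
  ≡-trans (ends false) (sym (ends true))
  where
  ends : ∀ h → ∑[ v < m ] flagCount h (lookup P (t v)) ≡ length L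
  ends h = ≡-trans (sum-cong-≗ (λ v → count-↭ _ (↭-sym (halfEdges↭ v)))) (∑-flagCount-halfEdgesAt h L)

-- The pot {a^r, a â â}

aEnd âEnd : Label 1
aEnd = zero , false
âEnd = zero , true

tile : ℕ → ℕ → Tile 1
tile i j = replicate i aEnd ++ replicate j âEnd

length-tile : ∀ i j → length (tile i j) ≡ i + j
length-tile i j = ≡-trans (length-++ (replicate i aEnd)) (cong₂ _+_ (length-replicate i) (length-replicate j))

flagCount-tile : ∀ h i j → flagCount h (tile i j) ≡ (if h then j else i)
flagCount-tile false zero    zero    = refl
flagCount-tile false zero    (suc j) = flagCount-tile false zero j
flagCount-tile false (suc i) j       = cong suc (flagCount-tile false i j)
flagCount-tile true  zero    zero    = refl
flagCount-tile true  zero    (suc j) = cong suc (flagCount-tile true zero j)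
flagCount-tile true  (suc i) j       = flagCount-tile true i j

orient : ∀ {m} → Graph m → List (LabeledEdge m 1)
orient = map (_, aEnd)

map-proj₁-orient : ∀ {m} (G : Graph m) → map proj₁ (orient G) ≡ G
map-proj₁-orient G = ≡-trans (sym (map-∘ G)) (map-id G)

âEnd∷tile↭tile : ∀ i j → âEnd ∷ tile i j ↭ tile i (suc j)
âEnd∷tile↭tile i j = ↭-sym (shift âEnd (replicate i aEnd) (replicate j âEnd))

halfEdgesAt-orient : ∀ {m} (G : Graph m) v → halfEdgesAt (orient G) v ↭ tile (outDegree G v) (inDegree G v)
halfEdgesAt-orient []              v = refl
halfEdgesAt-orient ((x , y) ∷ G) v with x ≟ v | y ≟ v
... | yes _ | yes _ = prep aEnd (↭-trans (prep âEnd (halfEdgesAt-orient G v)) (âEnd∷tile↭tile _ _))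
... | yes _ | no _  = prep aEnd (halfEdgesAt-orient G v)
... | no _  | yes _ = ↭-trans (prep âEnd (halfEdgesAt-orient G v)) (âEnd∷tile↭tile _ _)
... | no _  | no _  = halfEdgesAt-orient G v

wheelPot : ℕ → Pot 1
wheelPot r = tile r 0 ∷ tile 1 2 ∷ []

isHubTile : Fin 2 → ℕ
isHubTile zero    = 1
isHubTile (suc _) = 0

-- Summed over a realization the ends a and â cancel, leaving order = (r + 1) · (number of hub tiles).
wheelPot-ends : ∀ r i → suc (flagCount false (lookup (wheelPot r) i)) ≡
                        suc r * isHubTile i + flagCount true (lookup (wheelPot r) i)
wheelPot-ends r zero = begin
  suc (flagCount false (tile r 0))        ≡⟨ cong suc (flagCount-tile false r 0) ⟩
  suc r                                   ≡⟨ sym (+-identityʳ (suc r)) ⟩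
  suc r + 0                               ≡⟨ cong₂ _+_ (*-identityʳ (suc r)) (flagCount-tile true r 0) ⟨
  suc r * 1 + flagCount true (tile r 0)   ∎
  where open ≡-Reasoning
wheelPot-ends r (suc zero) = cong (_+ 2) (sym (*-zeroʳ (suc r)))

wheelPot-order-divisible : ∀ {r m} {H : Graph m} → Realizes (wheelPot r) H → suc r ∣ m
wheelPot-order-divisible {r} {m} R@(t , _) =
  divides hubs (≡-trans (+-cancelʳ-≡ _ m (suc r * hubs) order+ends) (*-comm (suc r) hubs))
  where
  open ≡-Reasoning
  hubs : ℕ
  hubs = ∑[ v < m ] isHubTile (t v)
  ends : Bool → ℕ
  ends h = ∑[ v < m ] flagCount h (lookup (wheelPot r) (t v))
  order+ends : m + ends false ≡ suc r * hubs + ends false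
  order+ends = begin
    m + ends false
      ≡⟨ ∑-suc (λ v → flagCount false (lookup (wheelPot r) (t v))) ⟨
    ∑[ v < m ] suc (flagCount false (lookup (wheelPot r) (t v)))
      ≡⟨ sum-cong-≗ (wheelPot-ends r ∘ t) ⟩
    ∑[ v < m ] (suc r * isHubTile (t v) + flagCount true (lookup (wheelPot r) (t v)))
      ≡⟨ ∑-distrib-+ (λ v → suc r * isHubTile (t v)) (λ v → flagCount true (lookup (wheelPot r) (t v))) ⟩
    ∑[ v < m ] (suc r * isHubTile (t v)) + ends true
      ≡⟨ cong₂ _+_ (*-distribˡ-sum (suc r) (isHubTile ∘ t)) (realization-balanced R) ⟨
    suc r * hubs + ends false
      ∎

wheelPot-valid : ∀ {r} → r ≢ 3 → ValidPot (wheelPot r)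
wheelPot-valid {r} r≢3 = ((λ r↭3 → r≢3 (lengths r↭3)) ∷ []) ∷ [] ∷ []
  where
  lengths : tile r 0 ↭ tile 1 2 → r ≡ 3
  lengths r↭3 = ≡-trans (sym (≡-trans (length-tile r 0) (+-identityʳ r))) (↭-length r↭3)

wheelPot-realizes-wheel : ∀ r → Realizes (wheelPot r) (wheel (suc r))
wheelPot-realizes-wheel r = tileOf , orient W , map-proj₁-orient W , halfEdges↭
  where
  W : Graph (suc r)
  W = wheel (suc r)
  tileOf : Fin (suc r) → Fin 2
  tileOf zero    = zero
  tileOf (suc _) = suc zero
  halfEdges↭ : ∀ v → halfEdgesAt (orient W) v ↭ lookup (wheelPot r) (tileOf v)
  halfEdges↭ zero    = subst₂ (λ i j → halfEdgesAt (orient W) zero ↭ tile i j)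
                              wheel-outDegree-hub (wheel-inDegree-hub {r}) (halfEdgesAt-orient W zero)
  halfEdges↭ (suc j) = subst₂ (λ i j′ → halfEdgesAt (orient W) (suc j) ↭ tile i j′)
                              (wheel-outDegree-rim j) (wheel-inDegree-rim j) (halfEdgesAt-orient W (suc j))

wheelPot-scenario2 : ∀ {r} → 3 < r → Scenario2 (wheelPot r) (wheel (suc r))
wheelPot-scenario2 {r} 3<r = wheelPot-valid (>⇒≢ 3<r) , wheelPot-realizes-wheel r , smaller
  where
  smaller : ∀ m → 1 ≤ m → m < suc r → (H : Graph m) → ¬ Realizes (wheelPot r) H
  smaller m 1≤m m<n _ R = <⇒≱ m<n (∣⇒≤ {{>-nonZero 1≤m}} (wheelPot-order-divisible R))

single-tile-wheel : ∀ {k r} {x : Tile k} → Realizes (x ∷ []) (wheel (suc r)) → Fin r → r ≡ 3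
single-tile-wheel {r = r} {x} R j = begin
  r                   ≡⟨ wheel-degree-hub ⟨
  degree W zero       ≡⟨ sameTile zero ⟨
  length x            ≡⟨ sameTile (suc j) ⟩
  degree W (suc j)    ≡⟨ wheel-degree-rim j ⟩
  3                   ∎
  where
  open ≡-Reasoning
  W : Graph (suc r)
  W = wheel (suc r)
  sameTile : ∀ v → length x ≡ degree W v
  sameTile v with proj₁ R v | realization-tile-length {P = x ∷ []} R v
  ... | zero | tile≡degree = tile≡degree

realizes-wheel⇒two-tile-types : ∀ {k r} {P : Pot k} → 3 < r → Realizes P (wheel (suc r)) → 2 ≤ length P
realizes-wheel⇒two-tile-types {P = []}          _             (t , _) with t zero
... | ()
realizes-wheel⇒two-tile-types {P = _ ∷ []}      3<r@(s≤s _) R = contradiction (single-tile-wheel R zero) (>⇒≢ 3<r)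
realizes-wheel⇒two-tile-types {P = _ ∷ _ ∷ _}   _             _ = s≤s (s≤s z≤n)

realizes-wheel⇒some-bond : ∀ {k r} {P : Pot k} → 0 < r → Realizes P (wheel (suc r)) → 1 ≤ k
realizes-wheel⇒some-bond {zero}  {P = P} (s≤s z≤n) R with () ← realizes-no-bonds {P = P} R
realizes-wheel⇒some-bond {suc k}           _         _ = s≤s z≤n

corollary1 : (n : ℕ) → 4 < n → T₂ (wheel n) 2 × B₂ (wheel n) 1
corollary1 (suc r) (s≤s 3<r) =
    ((1 , wheelPot r , refl , scenario) , λ _ P s → realizes-wheel⇒two-tile-types {P = P} 3<r (realization {P = P} s))
  , ((wheelPot r , scenario) , λ _ P s → realizes-wheel⇒some-bond {P = P} (≤-trans (s≤s z≤n) 3<r) (realization {P = P} s))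
  where
  scenario : Scenario2 (wheelPot r) (wheel (suc r))
  scenario = wheelPot-scenario2 3<r
  realization : ∀ {k} {P : Pot k} → Scenario2 P (wheel (suc r)) → Realizes P (wheel (suc r))
  realization = proj₁ ∘ proj₂
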